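{- Let $X_1,\ldots,X_n$ be nonempty finite sets with $|X_i|=q_i$, and let $X=\prod_{i=1}^n X_i$ with the RT metric $\rho$. Let $D=\{d_1,\ldots,d_k\}\subseteq\{1,\ldots,n\}$ with $1\le d_1<\cdots<d_k\le n$. Define graphs recursively by $H_1=K_{q_{d_1}}(q_1q_2\cdots q_{d_1-1})$ and $H_j=\left[(q_{d_{j-1}+1}\cdots q_{d_j-1})\,H_{j-1}\right]^{q_{d_j}}$ for $j=2,\ldots,k$. Then the distance graph satisfies $$G(X,D)\cong (q_{d_k+1}\cdots q_n)\,H_k,$$ i.e. $G(X,D)\cong q_{d_k+1}\cdots q_n\left[q_{d_{k-1}+1}\cdots q_{d_k-1}\left[\cdots\left[q_{d_1+1}\cdots q_{d_2-1}K_{q_{d_1}}(q_1\cdots q_{d_1-1})\right]^{q_{d_2}}\cdots\right]^{q_{d_{k-1}}}\right]^{q_{d_k}}$, where any empty product of the $q_i$ is taken to be $1$.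
   Context: For $x=(x_1,\ldots,x_n),y=(y_1,\ldots,y_n)\in X=\prod_{i=1}^nX_i$, the RT metric is $\rho(x,y)=\max\{i: x_i\neq y_i\}$ if $x\neq y$, and $\rho(x,x)=0$. For a metric space $(X,d)$ and a set $D$ of positive reals, the distance graph $G(X,D)$ has vertex set $X$ and an edge $xy$ for distinct $x,y\in X$ whenever $d(x,y)\in D$. For a graph $G$ and positive integer $m$, $mG$ denotes the disjoint union of $m$ copies of $G$, and $[G]^m$ denotes the join of $m$ copies of $G$ (disjoint union of the copies together with all edges between vertices of different copies). $K_r(m)$ denotes the complete $r$-partite graph with every part of size $m$. -}

module Defs where

open import Data.Nat using (ℕ; zero; suc; _+_; _*_; _∸_; _≤ᵇ_)
open import Data.Bool using (Bool; true; false; if_then_else_; _∧_)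
open import Data.Fin using (Fin; zero; suc; toℕ; fromℕ; inject₁)
open import Data.List using (List; map; allFin)
open import Data.Nat.ListAction using (product)
open import Data.Product using (Σ; ∃; _×_; _,_)
open import Data.Unit using (⊤; tt)
open import Function using (_∘_)
open import Function.Bundles using (_↔_; _⇔_; Inverse)
open import Relation.Binary.PropositionalEquality using (_≡_; _≢_; refl; cong)
open import Relation.Binary.Definitions using (DecidableEquality)
open import Relation.Nullary using (Dec; yes; no)

record Graph : Set₁ where
  field
    V   : Set
    Adj : V → V → Set
open Graph public

_≅_ : Graph → Graph → Set
G ≅ H = Σ (V G ↔ V H) λ f →
  ∀ x y → Adj G x y ⇔ Adj H (Inverse.to f x) (Inverse.to f y)

-- K_r(m): complete r-partite graph, every part of size m
-- vertex (a , b): part a, element b of that part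
K : ℕ → ℕ → Graph
K r m = record { V = Fin r × Fin m
               ; Adj = λ { (a , _) (a' , _) → a ≢ a' } }

copies : ℕ → Graph → Graph
copies m G = record { V = Fin m × V G
                    ; Adj = λ { (c , x) (c' , y) → c ≡ c' × Adj G x y } }

join : ℕ → Graph → Graph
join m G = record { V = Fin m × V G
                  ; Adj = λ { (c , x) (c' , y) →
                        (c ≢ c') ⊎' (c ≡ c' × Adj G x y) } }
  where
  open import Data.Sum using () renaming (_⊎_ to _⊎'_)

-- Product space X = X_1 × ... × X_n (coordinate 1 is Fin index zero)

Prod : (n : ℕ) → (Fin n → Set) → Set
Prod zero    X = ⊤
Prod (suc n) X = X zero × Prod n (X ∘ suc)

-- RT metric: ρ(x,y) = max{ i : x_i ≠ y_i } (1-indexed), 0 if x = y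
ρ : ∀ n (X : Fin n → Set) → (∀ i → DecidableEquality (X i)) →
    Prod n X → Prod n X → ℕ
ρ zero    X dec x y = 0
ρ (suc n) X dec (a , xs) (b , ys) with ρ n (X ∘ suc) (dec ∘ suc) xs ys
... | suc r = suc (suc r)
... | zero with dec zero a b
...   | yes _ = 0
...   | no  _ = 1

decFromFin : ∀ {A : Set} {q} → A ↔ Fin q → DecidableEquality A
decFromFin {A} f x y with Inverse.to f x Data.Fin.≟ Inverse.to f y
  where import Data.Fin
... | yes e = yes (begin x ≡⟨ sym (Inverse.strictlyInverseʳ f x) ⟩
                         Inverse.from f (Inverse.to f x) ≡⟨ cong (Inverse.from f) e ⟩
                         Inverse.from f (Inverse.to f y) ≡⟨ Inverse.strictlyInverseʳ f y ⟩
                         y ∎)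
  where open Relation.Binary.PropositionalEquality using (sym)
        open Relation.Binary.PropositionalEquality.≡-Reasoning
        import Relation.Binary.PropositionalEquality
... | no ne = no (λ e → ne (cong (Inverse.to f) e))

-- distance graph G(X, D) for X = Π X_i with the RT metric,
-- D = { d j : j ∈ Fin k }
DistGraph : ∀ n (X : Fin n → Set) (q : Fin n → ℕ) → (∀ i → X i ↔ Fin (q i)) →
            ∀ k → (Fin k → ℕ) → Graph
DistGraph n X q iso k d = record
  { V = Prod n X
  ; Adj = λ x y → x ≢ y × ∃ λ j → d j ≡ ρ n X (λ i → decFromFin (iso i)) x y }

-- prodRange q a b = ∏_{a ≤ i ≤ b} q_i   (i ranging over 1..n)
prodRange : ∀ {n} → (Fin n → ℕ) → ℕ → ℕ → ℕ
prodRange {n} q a b = product (map f (allFin n))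
  where
  f : Fin n → ℕ
  f i = if (a ≤ᵇ suc (toℕ i)) ∧ (suc (toℕ i) ≤ᵇ b) then q i else 1

qAt : ∀ {n} → (Fin n → ℕ) → ℕ → ℕ
qAt q a = prodRange q a a

-- H_j, with D given by d : Fin (suc m) → ℕ (d zero = d_1, ...),
-- H computed for the last index
H : ∀ {n} → (Fin n → ℕ) → ∀ m → (Fin (suc m) → ℕ) → Graph
H q zero    d = K (qAt q (d zero)) (prodRange q 1 (d zero ∸ 1))
H q (suc m) d =
  join (qAt q (d (fromℕ (suc m))))
       (copies (prodRange q (suc (d (inject₁ (fromℕ m)))) (d (fromℕ (suc m)) ∸ 1))
               (H q m (d ∘ inject₁)))

-- Reading the RT metric from the top coordinate down, two points are adjacent in G(X, D) iff
-- the highest coordinate in which they differ has its index in D. Hence G(X, D) is the iterated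
-- lexicographic product  L_n [ L_{n-1} [ ⋯ [ L_1 ] ⋯ ] ],  where L_i has q_i vertices and is
-- complete if i ∈ D and edgeless otherwise. The lexicographic product is associative, and a run
-- of consecutive edgeless factors is a single edgeless factor on the product of their vertex
-- sets. Grouping the factors between consecutive elements of D therefore yields, factor by
-- factor, the joins (complete factors) and disjoint unions (edgeless factors) defining H_k.

module Submission where

open import Defs
open import Data.Nat using (ℕ; zero; suc; _≤_; _<_)
open import Data.Fin using (Fin; fromℕ) renaming (_<_ to _<ᶠ_)
open import Function.Bundles using (_↔_)

open import Algebra.Properties.CommutativeSemigroup using (x∙yz≈y∙xz)
open import Data.Bool using (if_then_else_; _∧_)
open import Data.Empty using (⊥; ⊥-elim)
open import Data.Fin using (zero; suc; toℕ; inject₁)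
open import Data.Fin.Properties using (*↔×; 1↔⊤; toℕ-fromℕ; toℕ-inject₁; inject₁ℕ<)
open import Data.Fin.Relation.Unary.Top using (view; ‵fromℕ; ‵inject₁)
open import Data.List using (List; []; _∷_; map; allFin)
open import Data.List.Properties using (map-tabulate)
open import Data.Nat using (_*_; _∸_; _≤ᵇ_; z≤n; s≤s; _≤′_; ≤′-reflexive; ≤′-step)
open import Data.Nat.ListAction using (product)
open import Data.Nat.Properties
  using ( *-identityˡ; *-identityʳ; *-commutativeSemigroup; ≤-refl; ≤-trans; <⇒≤; <⇒≱
        ; <-irrefl; ≤-<-trans; m≤n⇒m≤1+n; ≤⇒≤′; ≤′⇒≤)
open import Data.Product using (∃; _×_; _,_; proj₁; proj₂)
open import Data.Product.Algebra using (×-comm; ×-assoc)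
open import Data.Product.Function.NonDependent.Propositional using (_×-⇔_; _×-↔_)
open import Data.Sum using (_⊎_; inj₁; inj₂; map₁)
open import Data.Sum.Function.Propositional using (_⊎-⇔_)
open import Data.Unit using (⊤; tt)
open import Function using (_∘_; id)
open import Function.Bundles using (Inverse; Injection; _⇔_; mk⇔; mk↔ₛ′)
import Function.Properties.Equivalence as ⇔
open import Function.Properties.Inverse using (↔-refl; ↔-sym; ↔-trans; Inverse⇒Injection)
open import Function.Related.TypeIsomorphisms using (¬-cong-⇔)
open import Relation.Binary.Bundles using (Setoid)
open import Relation.Binary.Definitions using (DecidableEquality)
open import Relation.Binary.PropositionalEquality
  using (_≡_; _≢_; refl; sym; trans; cong; cong₂; subst; subst₂; module ≡-Reasoning)
open import Relation.Binary.Reasoning.Syntax using (module ≃-syntax)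
open import Relation.Nullary using (¬_; yes; no)

private
  variable
    A B P Q : Set
    G₁ G₂ G₃ G₁′ G₂′ : Graph

-- _≅_ unfolds to a Σ-type from which Agda cannot recover the two graphs; this record carries
-- the same data but keeps the graphs visible to unification.
infix 4 _≃_

record _≃_ (G H : Graph) : Set where
  constructor mk≃
  field
    bijection : V G ↔ V H
    adjacency : ∀ x y → Adj G x y ⇔ Adj H (Inverse.to bijection x) (Inverse.to bijection y)

≃⇒≅ : G₁ ≃ G₂ → G₁ ≅ G₂
≃⇒≅ (mk≃ f p) = f , p

≃-refl : G₁ ≃ G₁
≃-refl = mk≃ ↔-refl λ _ _ → ⇔.refl

≃-sym : G₁ ≃ G₂ → G₂ ≃ G₁
≃-sym {G₁} {G₂} (mk≃ f p) = mk≃ (↔-sym f) λ x y → ⇔.sym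
  (subst₂ (λ x′ y′ → Adj G₁ (from x) (from y) ⇔ Adj G₂ x′ y′)
          (Inverse.strictlyInverseˡ f x) (Inverse.strictlyInverseˡ f y) (p (from x) (from y)))
  where open Inverse f using (from)

≃-trans : G₁ ≃ G₂ → G₂ ≃ G₃ → G₁ ≃ G₃
≃-trans (mk≃ f p) (mk≃ g q) = mk≃ (↔-trans f g) λ x y → ⇔.trans (p x y) (q _ _)

≡⇒≃ : G₁ ≡ G₂ → G₁ ≃ G₂
≡⇒≃ refl = ≃-refl

≃-setoid : Setoid _ _
≃-setoid = record
  { Carrier       = Graph
  ; _≈_           = _≃_
  ; isEquivalence = record { refl = ≃-refl ; sym = ≃-sym ; trans = ≃-trans }
  }

module ≃-Reasoning where
  open import Relation.Binary.Reasoning.Setoid ≃-setoid public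
    hiding (step-≈; step-≈˘; step-≈-⟩; step-≈-⟨)
    renaming (≈-go to ≃-go)
  open ≃-syntax _IsRelatedTo_ _IsRelatedTo_ ≃-go ≃-sym public

≡⇔to≡to : (f : A ↔ B) {x y : A} → (x ≡ y) ⇔ (Inverse.to f x ≡ Inverse.to f y)
≡⇔to≡to f = mk⇔ (cong (Inverse.to f)) (Injection.injective (Inverse⇒Injection f))

infixl 7 _[_]

_[_] : Graph → Graph → Graph
G [ H ] = record
  { V   = V G × V H
  ; Adj = λ (g , h) (g′ , h′) → Adj G g g′ ⊎ (g ≡ g′ × Adj H h h′)
  }

CompleteIf : Set → Set → Graph
CompleteIf P A = record { V = A ; Adj = λ a b → P × a ≢ b }

Complete Edgeless : Set → Graph
Complete = CompleteIf ⊤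
Edgeless = CompleteIf ⊥

K₁ : Graph
K₁ = Edgeless ⊤

[]-cong : G₁ ≃ G₁′ → G₂ ≃ G₂′ → G₁ [ G₂ ] ≃ G₁′ [ G₂′ ]
[]-cong (mk≃ f p) (mk≃ g q) =
  mk≃ (f ×-↔ g) λ (x , u) (y , v) → p x y ⊎-⇔ (≡⇔to≡to f ×-⇔ q u v)

[]-assoc : G₁ [ G₂ ] [ G₃ ] ≃ G₁ [ G₂ [ G₃ ] ]
[]-assoc = mk≃ (×-assoc _ _ _ _) λ _ _ → mk⇔
  (λ { (inj₁ (inj₁ e))          → inj₁ e
     ; (inj₁ (inj₂ (refl , e))) → inj₂ (refl , inj₁ e)
     ; (inj₂ (refl , e))        → inj₂ (refl , inj₂ (refl , e)) })
  (λ { (inj₁ e)                         → inj₁ (inj₁ e)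
     ; (inj₂ (refl , inj₁ e))           → inj₁ (inj₂ (refl , e))
     ; (inj₂ (refl , inj₂ (refl , e))) → inj₂ (refl , e) })

[]-identityˡ : K₁ [ G₁ ] ≃ G₁
[]-identityˡ = mk≃ (mk↔ₛ′ proj₂ (tt ,_) (λ _ → refl) (λ _ → refl)) λ _ _ →
  mk⇔ (λ { (inj₁ (() , _)) ; (inj₂ (_ , e)) → e }) (λ e → inj₂ (refl , e))

[]-identityʳ : G₁ [ K₁ ] ≃ G₁
[]-identityʳ = mk≃ (mk↔ₛ′ proj₁ (_, tt) (λ _ → refl) (λ _ → refl)) λ _ _ →
  mk⇔ (λ { (inj₁ e) → e ; (inj₂ (_ , () , _)) }) inj₁

CompleteIf-cong : P ⇔ Q → (f : A ↔ B) → CompleteIf P A ≃ CompleteIf Q B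
CompleteIf-cong P⇔Q f = mk≃ f λ _ _ → P⇔Q ×-⇔ ¬-cong-⇔ (≡⇔to≡to f)

CompleteIf-yes : P → CompleteIf P A ≃ Complete A
CompleteIf-yes p = CompleteIf-cong (mk⇔ _ (λ _ → p)) ↔-refl

CompleteIf-no : ¬ P → CompleteIf P A ≃ Edgeless A
CompleteIf-no ¬p = CompleteIf-cong (mk⇔ ¬p ⊥-elim) ↔-refl

Edgeless-[] : Edgeless A [ Edgeless B ] ≃ Edgeless (A × B)
Edgeless-[] = mk≃ ↔-refl λ _ _ → mk⇔ (λ { (inj₁ (() , _)) ; (inj₂ (_ , () , _)) }) λ ()

Edgeless-Fin-[] : ∀ {m n} → Edgeless (Fin m) [ Edgeless (Fin n) ] ≃ Edgeless (Fin (m * n))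
Edgeless-Fin-[] = ≃-trans Edgeless-[] (CompleteIf-cong ⇔.refl (↔-sym *↔×))

join≃ : ∀ c → join c G₁ ≃ Complete (Fin c) [ G₁ ]
join≃ c = mk≃ ↔-refl λ { (_ , _) (_ , _) → mk⇔ (map₁ (tt ,_)) (map₁ proj₂) }

copies≃ : ∀ c → copies c G₁ ≃ Edgeless (Fin c) [ G₁ ]
copies≃ c = mk≃ ↔-refl λ { (_ , _) (_ , _) → mk⇔ inj₂ λ { (inj₁ (() , _)) ; (inj₂ e) → e } }

K≃ : ∀ r m → K r m ≃ Complete (Fin r) [ Edgeless (Fin m) ]
K≃ r m = mk≃ ↔-refl λ { (_ , _) (_ , _) →
  mk⇔ (λ a≢a′ → inj₁ (tt , a≢a′)) λ { (inj₁ (_ , a≢a′)) → a≢a′ ; (inj₂ (_ , () , _)) } }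

-- The factors are indexed from 1; L 0 is never used.
Lex : (ℕ → Graph) → ℕ → Graph
Lex L zero    = K₁
Lex L (suc t) = L (suc t) [ Lex L t ]

Lex-cong : ∀ {L L′} → (∀ i → L (suc i) ≃ L′ (suc i)) → ∀ t → Lex L t ≃ Lex L′ t
Lex-cong L≃L′ zero    = ≃-refl
Lex-cong L≃L′ (suc t) = []-cong (L≃L′ t) (Lex-cong L≃L′ t)

Lex-bottom : ∀ L t → Lex L (suc t) ≃ Lex (L ∘ suc) t [ L 1 ]
Lex-bottom L zero    = ≃-trans []-identityʳ (≃-sym []-identityˡ)
Lex-bottom L (suc t) = ≃-trans ([]-cong ≃-refl (Lex-bottom L t)) (≃-sym []-assoc)

ρ-refl : ∀ n X dec (x : Prod n X) → ρ n X dec x x ≡ 0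
ρ-refl zero    X dec _        = refl
ρ-refl (suc n) X dec (a , xs) rewrite ρ-refl n (X ∘ suc) (dec ∘ suc) xs with dec zero a a
... | yes _  = refl
... | no a≢a = ⊥-elim (a≢a refl)

ρ≡0⇒≡ : ∀ n X dec (x y : Prod n X) → ρ n X dec x y ≡ 0 → x ≡ y
ρ≡0⇒≡ zero    X dec _        _        _ = refl
ρ≡0⇒≡ (suc n) X dec (a , xs) (b , ys) with ρ n (X ∘ suc) (dec ∘ suc) xs ys in eq
... | suc _ = λ ()
... | zero with dec zero a b
...   | yes refl = λ _ → cong (a ,_) (ρ≡0⇒≡ n (X ∘ suc) (dec ∘ suc) xs ys eq)
...   | no _     = λ ()

RTGraph : ∀ n (X : Fin n → Set) → (∀ i → DecidableEquality (X i)) → (ℕ → Set) → Graph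
RTGraph n X dec D = record { V = Prod n X ; Adj = λ x y → x ≢ y × D (ρ n X dec x y) }

RTGraph-adj-suc : ∀ n X dec D a b (xs ys : Prod n (X ∘ suc)) →
  Adj (RTGraph (suc n) X dec D) (a , xs) (b , ys) ⇔
  (Adj (RTGraph n (X ∘ suc) (dec ∘ suc) (D ∘ suc)) xs ys ⊎ (xs ≡ ys × (D 1 × a ≢ b)))
RTGraph-adj-suc n X dec D a b xs ys with ρ n (X ∘ suc) (dec ∘ suc) xs ys in eq
... | suc _ = mk⇔ (λ (_ , Dρ) → inj₁ (xs≢ys , Dρ)) λ
  { (inj₁ (_ , Dρ))      → (xs≢ys ∘ cong proj₂) , Dρ
  ; (inj₂ (xs≡ys , _)) → ⊥-elim (xs≢ys xs≡ys) }
  where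
  xs≢ys : xs ≢ ys
  xs≢ys refl with () ← trans (sym (ρ-refl n (X ∘ suc) (dec ∘ suc) xs)) eq
... | zero with ρ≡0⇒≡ n (X ∘ suc) (dec ∘ suc) xs ys eq | dec zero a b
...   | refl | yes refl = mk⇔ (λ (x≢x , _) → ⊥-elim (x≢x refl)) λ
  { (inj₁ (x≢x , _))     → ⊥-elim (x≢x refl)
  ; (inj₂ (_ , _ , a≢a)) → ⊥-elim (a≢a refl) }
...   | refl | no a≢b   = mk⇔ (λ (_ , D1) → inj₂ (refl , D1 , a≢b)) λ
  { (inj₁ (x≢x , _))    → ⊥-elim (x≢x refl)
  ; (inj₂ (_ , D1 , _)) → (a≢b ∘ cong proj₁) , D1 }

RTGraph-suc : ∀ n X dec D →
  RTGraph (suc n) X dec D ≃ RTGraph n (X ∘ suc) (dec ∘ suc) (D ∘ suc) [ CompleteIf (D 1) (X zero) ]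
RTGraph-suc n X dec D = mk≃ (×-comm _ _) λ (a , xs) (b , ys) → RTGraph-adj-suc n X dec D a b xs ys

-- The factors of prodRange q a b, whose local function in Defs cannot be referred to.
rangeFactor : ∀ {n} → (Fin n → ℕ) → ℕ → ℕ → Fin n → ℕ
rangeFactor q a b i = if (a ≤ᵇ suc (toℕ i)) ∧ (suc (toℕ i) ≤ᵇ b) then q i else 1

product-map-allFin-suc : ∀ {n} (f : Fin (suc n) → ℕ) →
  product (map f (allFin (suc n))) ≡ f zero * product (map (f ∘ suc) (allFin n))
product-map-allFin-suc f =
  cong ((f zero *_) ∘ product) (trans (map-tabulate suc f) (sym (map-tabulate id (f ∘ suc))))

product-map-const-1 : (xs : List A) → product (map (λ _ → 1) xs) ≡ 1
product-map-const-1 []       = refl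
product-map-const-1 (_ ∷ xs) = trans (*-identityˡ _) (product-map-const-1 xs)

prodRange-1-0 : ∀ {n} (q : Fin n → ℕ) → prodRange q 1 0 ≡ 1
prodRange-1-0 {n} q = product-map-const-1 (allFin n)

prodRange-1-suc : ∀ {n} (q : Fin (suc n) → ℕ) b →
  prodRange q 1 (suc b) ≡ q zero * prodRange (q ∘ suc) 1 b
prodRange-1-suc q b = product-map-allFin-suc (rangeFactor q 1 (suc b))

prodRange-shift : ∀ {n} (q : Fin (suc n) → ℕ) a b →
  prodRange q (suc (suc a)) (suc b) ≡ prodRange (q ∘ suc) (suc a) b
prodRange-shift q a b =
  trans (product-map-allFin-suc (rangeFactor q (suc (suc a)) (suc b))) (*-identityˡ _)

qAt-shift : ∀ {n} (q : Fin (suc n) → ℕ) b → qAt q (suc (suc b)) ≡ qAt (q ∘ suc) (suc b)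
qAt-shift q b = prodRange-shift q b (suc b)

qAt-1 : ∀ {n} (q : Fin (suc n) → ℕ) → qAt q 1 ≡ q zero
qAt-1 q = begin
  prodRange q 1 1                  ≡⟨ prodRange-1-suc q 0 ⟩
  q zero * prodRange (q ∘ suc) 1 0 ≡⟨ cong (q zero *_) (prodRange-1-0 (q ∘ suc)) ⟩
  q zero * 1                       ≡⟨ *-identityʳ _ ⟩
  q zero                           ∎
  where open ≡-Reasoning

prodRange-empty : ∀ {n} (q : Fin n → ℕ) a → prodRange q (suc a) a ≡ 1
prodRange-empty         q zero    = prodRange-1-0 q
prodRange-empty {zero}  q (suc a) = refl
prodRange-empty {suc n} q (suc a) = trans (prodRange-shift q a a) (prodRange-empty (q ∘ suc) a)

prodRange-sucʳ : ∀ {n} (q : Fin n → ℕ) {a b} → a ≤ b →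
  prodRange q (suc a) (suc b) ≡ qAt q (suc b) * prodRange q (suc a) b
prodRange-sucʳ {zero}  q _ = refl
prodRange-sucʳ {suc n} q {zero} {zero} _ =
  sym (trans (cong (qAt q 1 *_) (prodRange-1-0 q)) (*-identityʳ _))
prodRange-sucʳ {suc n} q {zero} {suc b} _ = begin
  prodRange q 1 (suc (suc b))
    ≡⟨ prodRange-1-suc q (suc b) ⟩
  q zero * prodRange q′ 1 (suc b)
    ≡⟨ cong (q zero *_) (prodRange-sucʳ q′ z≤n) ⟩
  q zero * (qAt q′ (suc b) * prodRange q′ 1 b)
    ≡⟨ x∙yz≈y∙xz *-commutativeSemigroup (q zero) (qAt q′ (suc b)) (prodRange q′ 1 b) ⟩
  qAt q′ (suc b) * (q zero * prodRange q′ 1 b)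
    ≡⟨ cong₂ _*_ (qAt-shift q b) (prodRange-1-suc q b) ⟨
  qAt q (suc (suc b)) * prodRange q 1 (suc b) ∎
  where
  open ≡-Reasoning
  q′ = q ∘ suc
prodRange-sucʳ {suc n} q {suc a} {suc b} (s≤s a≤b) = begin
  prodRange q (suc (suc a)) (suc (suc b))
    ≡⟨ prodRange-shift q a (suc b) ⟩
  prodRange (q ∘ suc) (suc a) (suc b)
    ≡⟨ prodRange-sucʳ (q ∘ suc) a≤b ⟩
  qAt (q ∘ suc) (suc b) * prodRange (q ∘ suc) (suc a) b
    ≡⟨ cong₂ _*_ (qAt-shift q b) (prodRange-shift q a b) ⟨
  qAt q (suc (suc b)) * prodRange q (suc (suc a)) (suc b) ∎
  where open ≡-Reasoning

Layers : ∀ {n} → (Fin n → ℕ) → (ℕ → Set) → ℕ → Graph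
Layers q D i = CompleteIf (D i) (Fin (qAt q i))

RTGraph≃Lex : ∀ n X dec (q : Fin n → ℕ) → (∀ i → X i ↔ Fin (q i)) → ∀ D →
  RTGraph n X dec D ≃ Lex (Layers q D) n
RTGraph≃Lex zero    X dec q iso D =
  mk≃ ↔-refl λ _ _ → mk⇔ (λ (x≢x , _) → ⊥-elim (x≢x refl)) λ ()
RTGraph≃Lex (suc n) X dec q iso D = begin
  RTGraph (suc n) X dec D
    ≃⟨ RTGraph-suc n X dec D ⟩
  RTGraph n (X ∘ suc) (dec ∘ suc) (D ∘ suc) [ CompleteIf (D 1) (X zero) ]
    ≃⟨ []-cong (RTGraph≃Lex n (X ∘ suc) (dec ∘ suc) (q ∘ suc) (iso ∘ suc) (D ∘ suc))
               (CompleteIf-cong ⇔.refl (subst (X zero ↔_) (cong Fin (sym (qAt-1 q))) (iso zero))) ⟩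
  Lex (Layers (q ∘ suc) (D ∘ suc)) n [ Layers q D 1 ]
    ≃⟨ []-cong (Lex-cong (λ i → ≡⇒≃ (cong (CompleteIf _ ∘ Fin) (qAt-shift q i))) n) ≃-refl ⟨
  Lex (Layers q D ∘ suc) n [ Layers q D 1 ]
    ≃⟨ Lex-bottom (Layers q D) n ⟨
  Lex (Layers q D) (suc n) ∎
  where open ≃-Reasoning

module _ {n} (q : Fin n → ℕ) (D : ℕ → Set) where

  Lex-merge : ∀ {a t} → a ≤′ t → (∀ c → a < c → c ≤ t → ¬ D c) →
    Lex (Layers q D) t ≃ Edgeless (Fin (prodRange q (suc a) t)) [ Lex (Layers q D) a ]
  Lex-merge {a} (≤′-reflexive refl) _ = begin
    Lex (Layers q D) a
      ≃⟨ []-identityˡ ⟨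
    K₁ [ Lex (Layers q D) a ]
      ≃⟨ []-cong (CompleteIf-cong ⇔.refl (↔-sym 1↔⊤)) ≃-refl ⟩
    Edgeless (Fin 1) [ Lex (Layers q D) a ]
      ≡⟨ cong (λ k → Edgeless (Fin k) [ Lex (Layers q D) a ]) (prodRange-empty q a) ⟨
    Edgeless (Fin (prodRange q (suc a) a)) [ Lex (Layers q D) a ] ∎
    where open ≃-Reasoning
  Lex-merge {a} (≤′-step {t} a≤′t) unflagged = begin
    Layers q D (suc t) [ Lex (Layers q D) t ]
      ≃⟨ []-cong (CompleteIf-no (unflagged (suc t) (s≤s a≤t) ≤-refl))
                 (Lex-merge a≤′t λ c a<c c≤t → unflagged c a<c (m≤n⇒m≤1+n c≤t)) ⟩
    Edgeless (Fin (qAt q (suc t))) [ Edgeless (Fin (prodRange q (suc a) t)) [ Lex (Layers q D) a ] ]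
      ≃⟨ []-assoc ⟨
    Edgeless (Fin (qAt q (suc t))) [ Edgeless (Fin (prodRange q (suc a) t)) ] [ Lex (Layers q D) a ]
      ≃⟨ []-cong Edgeless-Fin-[] ≃-refl ⟩
    Edgeless (Fin (qAt q (suc t) * prodRange q (suc a) t)) [ Lex (Layers q D) a ]
      ≡⟨ cong (λ k → Edgeless (Fin k) [ Lex (Layers q D) a ]) (prodRange-sucʳ q a≤t) ⟨
    Edgeless (Fin (prodRange q (suc a) (suc t))) [ Lex (Layers q D) a ] ∎
    where
    open ≃-Reasoning
    a≤t = ≤′⇒≤ a≤′t

  Lex-gap : ∀ {a t} → a < t → D t → (∀ c → a < c → c < t → ¬ D c) →
    Lex (Layers q D) t ≃
    Complete (Fin (qAt q t)) [ Edgeless (Fin (prodRange q (suc a) (t ∸ 1))) [ Lex (Layers q D) a ] ]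
  Lex-gap (s≤s a≤t) Dt unflagged =
    []-cong (CompleteIf-yes Dt) (Lex-merge (≤⇒≤′ a≤t) λ c a<c c≤t → unflagged c a<c (s≤s c≤t))

StrictlyIncreasing : ∀ {m} → (Fin m → ℕ) → Set
StrictlyIncreasing d = ∀ i j → i <ᶠ j → d i < d j

inject₁<fromℕ : ∀ {m} (j : Fin m) → inject₁ j <ᶠ fromℕ m
inject₁<fromℕ {m} j = subst (toℕ (inject₁ j) <_) (sym (toℕ-fromℕ m)) (inject₁ℕ< j)

StrictlyIncreasing-inject₁ : ∀ {m} {d : Fin (suc m) → ℕ} →
  StrictlyIncreasing d → StrictlyIncreasing (d ∘ inject₁)
StrictlyIncreasing-inject₁ increasing i j i<j =
  increasing (inject₁ i) (inject₁ j) (subst₂ _<_ (sym (toℕ-inject₁ i)) (sym (toℕ-inject₁ j)) i<j)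

≤-last : ∀ {m} {d : Fin (suc m) → ℕ} → StrictlyIncreasing d → ∀ j → d j ≤ d (fromℕ m)
≤-last increasing j with view j
... | ‵fromℕ      = ≤-refl
... | ‵inject₁ j′ = <⇒≤ (increasing _ _ (inject₁<fromℕ j′))

<-last⇒inject₁ : ∀ {m} (d : Fin (suc m) → ℕ) j {c} → d j ≡ c → c < d (fromℕ m) →
  ∃ λ j′ → d (inject₁ j′) ≡ c
<-last⇒inject₁ d j dj≡c c<dₘ with view j
... | ‵fromℕ      = ⊥-elim (<-irrefl (sym dj≡c) c<dₘ)
... | ‵inject₁ j′ = j′ , dj≡c

Lex≃H : ∀ {n} (q : Fin n → ℕ) D m (d : Fin (suc m) → ℕ) → 0 < d zero → StrictlyIncreasing d →
  (∀ j → D (d j)) → (∀ c → c ≤ d (fromℕ m) → D c → ∃ λ j → d j ≡ c) →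
  Lex (Layers q D) (d (fromℕ m)) ≃ H q m d
Lex≃H q D zero d 0<d₀ _ flagged inImage = begin
  Lex (Layers q D) (d zero)
    ≃⟨ Lex-gap q D 0<d₀ (flagged zero) gap ⟩
  Complete (Fin (qAt q (d zero))) [ Edgeless (Fin (prodRange q 1 (d zero ∸ 1))) [ K₁ ] ]
    ≃⟨ []-cong ≃-refl []-identityʳ ⟩
  Complete (Fin (qAt q (d zero))) [ Edgeless (Fin (prodRange q 1 (d zero ∸ 1))) ]
    ≃⟨ K≃ _ _ ⟨
  H q zero d ∎
  where
  open ≃-Reasoning
  gap : ∀ c → 0 < c → c < d zero → ¬ D c
  gap c _ c<d₀ Dc with inImage c (<⇒≤ c<d₀) Dc
  ... | zero , refl = <-irrefl refl c<d₀
Lex≃H q D (suc m) d 0<d₀ increasing flagged inImage = begin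
  Lex (Layers q D) dₘ
    ≃⟨ Lex-gap q D d′ₘ<dₘ (flagged _) gap ⟩
  Complete (Fin (qAt q dₘ)) [ Edgeless (Fin M) [ Lex (Layers q D) (d′ (fromℕ m)) ] ]
    ≃⟨ []-cong ≃-refl ([]-cong ≃-refl (Lex≃H q D m d′ 0<d₀ increasing′ (flagged ∘ inject₁) inImage′)) ⟩
  Complete (Fin (qAt q dₘ)) [ Edgeless (Fin M) [ H q m d′ ] ]
    ≃⟨ ≃-trans (join≃ _) ([]-cong ≃-refl (copies≃ M)) ⟨
  H q (suc m) d ∎
  where
  open ≃-Reasoning
  d′ = d ∘ inject₁
  dₘ = d (fromℕ (suc m))
  M = prodRange q (suc (d′ (fromℕ m))) (dₘ ∸ 1)
  increasing′ = StrictlyIncreasing-inject₁ increasing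
  d′ₘ<dₘ = increasing _ _ (inject₁<fromℕ (fromℕ m))
  gap : ∀ c → d′ (fromℕ m) < c → c < dₘ → ¬ D c
  gap c d′ₘ<c c<dₘ Dc with inImage c (<⇒≤ c<dₘ) Dc
  ... | j , dj≡c with <-last⇒inject₁ d j dj≡c c<dₘ
  ...   | j′ , refl = <⇒≱ d′ₘ<c (≤-last increasing′ j′)
  inImage′ : ∀ c → c ≤ d′ (fromℕ m) → D c → ∃ λ j → d′ j ≡ c
  inImage′ c c≤d′ₘ Dc with inImage c (≤-trans c≤d′ₘ (<⇒≤ d′ₘ<dₘ)) Dc
  ... | j , dj≡c = <-last⇒inject₁ d j dj≡c (≤-<-trans c≤d′ₘ d′ₘ<dₘ)

theorem3p2 : (n : ℕ) (X : Fin n → Set) (q : Fin n → ℕ)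
    → (iso : ∀ i → X i ↔ Fin (q i))
    → (∀ i → 1 ≤ q i)
    → (m : ℕ) (d : Fin (suc m) → ℕ)
    → 1 ≤ d Fin.zero
    → (∀ i j → i <ᶠ j → d i < d j)
    → d (fromℕ m) ≤ n
    → DistGraph n X q iso (suc m) d ≅ copies (prodRange q (suc (d (fromℕ m))) n) (H q m d)
theorem3p2 n X q iso _ m d 1≤d₀ increasing dₘ≤n = ≃⇒≅ (begin
  DistGraph n X q iso (suc m) d
    ≡⟨⟩
  RTGraph n X dec D
    ≃⟨ RTGraph≃Lex n X dec q iso D ⟩
  Lex (Layers q D) n
    ≃⟨ Lex-merge q D (≤⇒≤′ dₘ≤n) above-dₘ ⟩
  Edgeless (Fin N) [ Lex (Layers q D) (d (fromℕ m)) ]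
    ≃⟨ []-cong ≃-refl (Lex≃H q D m d 1≤d₀ increasing (λ j → j , refl) (λ _ _ → id)) ⟩
  Edgeless (Fin N) [ H q m d ]
    ≃⟨ copies≃ N ⟨
  copies N (H q m d) ∎)
  where
  open ≃-Reasoning
  dec = λ i → decFromFin (iso i)
  D = λ r → ∃ λ j → d j ≡ r
  N = prodRange q (suc (d (fromℕ m))) n
  above-dₘ : ∀ c → d (fromℕ m) < c → c ≤ n → ¬ D c
  above-dₘ c dₘ<c _ (j , refl) = <⇒≱ dₘ<c (≤-last increasing j)
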